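{- Let $1/n\ll\alpha\ll 1/r$ where $n,r\in\mathbb N$ and $r\ge 3$. Suppose that $G$ is a digraph on $n$ vertices such that for every $x\in V(G)$, $d^+(x)\ge\left(1-\frac{1}{r-1}-\alpha\right)n$ or $d^-(x)\ge\left(1-\frac{1}{r-1}-\alpha\right)n$. If $G$ contains no copy of $T_r$, then $G$ contains an independent set of size at least $\left(\frac{1}{r-1}-r\alpha\right)n$.
   Context: Hierarchy notation: $0<a\ll b\ll c$ means the constants are chosen from right to left, each sufficiently small in terms of those to its right. A digraph has no loops and at most one edge in each direction between any two vertices; $d^\pm(x)$ are out-/indegree. $T_r$ is the transitive tournament on $r$ vertices.
   Formalization: The constant α in the hierarchy $1/n\ll\alpha\ll 1/r$ ranges only over the positive rationals. -}

module Defs where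

open import Data.Bool using (Bool; true; false)
open import Data.Nat using (ℕ; zero; suc; _∸_; _<_)
open import Data.Integer using (+_)
open import Data.Rational using (ℚ; _/_; 0ℚ)
open import Data.Fin using (Fin; toℕ)
open import Data.Fin.Subset using (Subset; _∈_)
open import Data.List using (length; filterᵇ; allFin)
open import Function.Definitions using (Injective)
open import Relation.Binary.PropositionalEquality using (_≡_)
open import Data.Product using (Σ; _×_)

-- No loops; edges in both directions between two vertices are allowed
-- (at most one edge in each direction is automatic for a relation).
record Digraph (n : ℕ) : Set where
  field
    adj     : Fin n → Fin n → Bool
    noLoops : ∀ x → adj x x ≡ false
open Digraph public

outdeg : ∀ {n} → Digraph n → Fin n → ℕ
outdeg {n} G x = length (filterᵇ (λ y → adj G x y) (allFin n))

indeg : ∀ {n} → Digraph n → Fin n → ℕ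
indeg {n} G x = length (filterᵇ (λ y → adj G y x) (allFin n))

-- G contains a copy of the transitive tournament T_r (vertices 0..r-1, edge i → j iff i < j):
-- an injective map f with every edge of T_r mapped to an edge of G.
ContainsTT : ∀ {n} → Digraph n → ℕ → Set
ContainsTT {n} G r =
  Σ (Fin r → Fin n) λ f →
    Injective _≡_ _≡_ f × (∀ i j → toℕ i < toℕ j → adj G (f i) (f j) ≡ true)

Independent : ∀ {n} → Digraph n → Subset n → Set
Independent G S = ∀ x y → x ∈ S → y ∈ S → adj G x y ≡ false

ℕtoℚ : ℕ → ℚ
ℕtoℚ m = + m / 1

-- 1/m as a rational (only used with m ≥ 2; value at 0 is irrelevant)
inv : ℕ → ℚ
inv zero    = 0ℚ
inv (suc m) = + 1 / suc m

module Submission where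

-- Call a vertex set U "D-dense" if every y ∈ U misses at most D
-- vertices of U either as out-neighbours or as in-neighbours.  The greedy lemma
-- below shows, by induction on k, that a D-dense U contains either a copy of
-- T_{k+2} or an independent set S with |U| ≤ |S| + k·D: pick x ∈ U (if U is
-- independent we are done); if x misses at most D out-neighbours, pass to
-- U ∩ N⁺(x), which is again D-dense and has lost at most D vertices, and put x
-- in front of the tournament found there.  The in-neighbour case is the same
-- argument in the reversed digraph Gᵒᵖ, which has the same tournaments (read
-- backwards) and the same independent sets.  For the proposition take U = V(G),
-- D = (1/(r-1) + α)n and k = r - 2: the degree condition makes V(G) D-dense,
-- T_r-freeness rules out the tournament, and |S| ≥ n - (r-2)D ≥ (1/(r-1) - rα)n.
-- This holds for every α > 0 and every n, so α₀ = 1 and n₀ = 0 suffice.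

open import Defs
open import Data.Bool using (Bool; true; false) renaming (_≟_ to _≟ᵇ_)
open import Data.Bool.Properties using (¬-not)
open import Data.Nat as ℕ using (ℕ; zero; suc; _≤_; _∸_; s≤s)
import Data.Nat.Properties as ℕ
import Data.Integer as ℤ
import Data.Integer.Properties as ℤ
import Data.Nat.Coprimality as Coprime
open import Data.Rational
  using (ℚ; mkℚ; 0ℚ; 1ℚ; _<_; _+_; _*_; _-_; -_; _/_; *≤*; *<*; nonNegative)
  renaming (_≤_ to _≤ℚ_)
open import Data.Rational.Properties
open import Data.Rational.Solver using (module +-*-Solver)
open import Data.Fin using (Fin; zero; suc; toℕ; opposite)
import Data.Fin.Properties as Fin
open import Data.Fin.Subset using (Subset; ∣_∣; _∈_; _∩_; _─_; ⊤; inside; outside)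
open import Data.Fin.Subset.Properties using (_∈?_; p∩q⊆p; p∩q⊆q; x∈p∩q⁺; ∩-identityˡ; ∣⊤∣≡n)
import Data.List as List
open import Data.Vec using ([]; _∷_; tabulate)
open import Data.Vec.Properties using (lookup∘tabulate; []=⇒lookup; lookup⇒[]=)
open import Data.Product using (Σ; _×_; _,_; ∃-syntax)
open import Data.Sum using (_⊎_; inj₁; inj₂; swap; [_,_]′) renaming (map to ⊎-map)
open import Relation.Nullary using (¬_; yes; no; contradiction)
open import Relation.Nullary.Decidable using (_×-dec_)
open import Relation.Binary.PropositionalEquality
open import Function.Definitions using (Injective)
open import Relation.Binary.Definitions using (tri<; tri≈; tri>)

ℕtoℚ-mkℚ : ∀ m → ℕtoℚ m ≡ mkℚ (ℤ.+ m) 0 (Coprime.sym (Coprime.1-coprimeTo m))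
ℕtoℚ-mkℚ m = normalize-coprime (Coprime.sym (Coprime.1-coprimeTo m))

ℕtoℚ-+ : ∀ a b → ℕtoℚ (a ℕ.+ b) ≡ ℕtoℚ a + ℕtoℚ b
ℕtoℚ-+ a b = begin
  ℤ.+ (a ℕ.+ b) / 1
    ≡⟨ cong₂ (λ u v → (u ℤ.+ v) / 1) (sym (ℤ.*-identityʳ (ℤ.+ a))) (sym (ℤ.*-identityʳ (ℤ.+ b))) ⟩
  (ℤ.+ a ℤ.* ℤ.+ 1 ℤ.+ ℤ.+ b ℤ.* ℤ.+ 1) / 1
    ≡⟨ cong₂ _+_ (ℕtoℚ-mkℚ a) (ℕtoℚ-mkℚ b) ⟨
  ℕtoℚ a + ℕtoℚ b
    ∎
  where open ≡-Reasoning

ℕtoℚ-mono : ∀ {a b} → a ≤ b → ℕtoℚ a ≤ℚ ℕtoℚ b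
ℕtoℚ-mono {a} {b} a≤b rewrite ℕtoℚ-mkℚ a | ℕtoℚ-mkℚ b =
  *≤* (ℤ.*-monoʳ-≤-nonNeg (ℤ.+ 1) (ℤ.+≤+ a≤b))

ℕtoℚ-nonNeg : ∀ a → 0ℚ ≤ℚ ℕtoℚ a
ℕtoℚ-nonNeg a = ℕtoℚ-mono (ℕ.z≤n {a})

ℕtoℚ*inv : ∀ k → ℕtoℚ (suc k) * inv (suc k) ≡ 1ℚ
ℕtoℚ*inv k =
  trans (cong₂ _*_ (ℕtoℚ-mkℚ (suc k)) (normalize-coprime (Coprime.1-coprimeTo (suc k))))
        (*-inverseʳ (mkℚ (ℤ.+ suc k) 0 (Coprime.sym (Coprime.1-coprimeTo (suc k)))))

*-nonNeg : ∀ {p q} → 0ℚ ≤ℚ p → 0ℚ ≤ℚ q → 0ℚ ≤ℚ p * q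
*-nonNeg {p} {q} 0≤p 0≤q =
  nonNegative⁻¹ (p * q) {{nonNeg*nonNeg⇒nonNeg p {{nonNegative 0≤p}} q {{nonNegative 0≤q}}}}

p≤p+q : ∀ p {q} → 0ℚ ≤ℚ q → p ≤ℚ p + q
p≤p+q p 0≤q = subst (_≤ℚ p + _) (+-identityʳ p) (+-monoʳ-≤ p 0≤q)

+-cancelʳ-≤ : ∀ p q r → p + r ≤ℚ q + r → p ≤ℚ q
+-cancelʳ-≤ p q r p+r≤q+r = subst₂ _≤ℚ_ (undo p) (undo q) (+-monoˡ-≤ (- r) p+r≤q+r)
  where
  undo : ∀ w → w + r + - r ≡ w
  undo w = trans (+-assoc w r (- r)) (trans (cong (λ t → w + t) (+-inverseʳ r)) (+-identityʳ w))

∣∩∣+∣─∣≡∣∣ : ∀ {n} (U A : Subset n) → ∣ U ∩ A ∣ ℕ.+ ∣ U ─ A ∣ ≡ ∣ U ∣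
∣∩∣+∣─∣≡∣∣ []            []            = refl
∣∩∣+∣─∣≡∣∣ (inside  ∷ U) (inside  ∷ A) = cong suc (∣∩∣+∣─∣≡∣∣ U A)
∣∩∣+∣─∣≡∣∣ (inside  ∷ U) (outside ∷ A) = trans (ℕ.+-suc _ _) (cong suc (∣∩∣+∣─∣≡∣∣ U A))
∣∩∣+∣─∣≡∣∣ (outside ∷ U) (inside  ∷ A) = ∣∩∣+∣─∣≡∣∣ U A
∣∩∣+∣─∣≡∣∣ (outside ∷ U) (outside ∷ A) = ∣∩∣+∣─∣≡∣∣ U A

∣∩─∣≤∣─∣ : ∀ {n} (U B A : Subset n) → ∣ U ∩ B ─ A ∣ ≤ ∣ U ─ A ∣
∣∩─∣≤∣─∣ []            []            []            = ℕ.z≤n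
∣∩─∣≤∣─∣ (u       ∷ U) (b       ∷ B) (inside  ∷ A) = ∣∩─∣≤∣─∣ U B A
∣∩─∣≤∣─∣ (inside  ∷ U) (inside  ∷ B) (outside ∷ A) = s≤s (∣∩─∣≤∣─∣ U B A)
∣∩─∣≤∣─∣ (inside  ∷ U) (outside ∷ B) (outside ∷ A) = ℕ.m≤n⇒m≤1+n (∣∩─∣≤∣─∣ U B A)
∣∩─∣≤∣─∣ (outside ∷ U) (b       ∷ B) (outside ∷ A) = ∣∩─∣≤∣─∣ U B A

∈tabulate⁺ : ∀ {n} {p : Fin n → Bool} {x} → p x ≡ true → x ∈ tabulate p
∈tabulate⁺ {p = p} {x} px = lookup⇒[]= x (tabulate p) (trans (lookup∘tabulate p x) px)

∈tabulate⁻ : ∀ {n} {p : Fin n → Bool} {x} → x ∈ tabulate p → p x ≡ true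
∈tabulate⁻ {p = p} {x} x∈p = trans (sym (lookup∘tabulate p x)) ([]=⇒lookup x∈p)

length-filter-tabulate : ∀ {m} {A : Set} (p : A → Bool) (f : Fin m → A) →
  List.length (List.filterᵇ p (List.tabulate f)) ≡ ∣ tabulate (λ i → p (f i)) ∣
length-filter-tabulate {zero}  p f = refl
length-filter-tabulate {suc m} p f with p (f zero)
... | true  = cong suc (length-filter-tabulate p (λ i → f (suc i)))
... | false = length-filter-tabulate p (λ i → f (suc i))

module _ {n : ℕ} where

  N⁺ N⁻ : Digraph n → Fin n → Subset n
  N⁺ G x = tabulate (λ y → adj G x y)
  N⁻ G x = tabulate (λ y → adj G y x)

  outdeg≡∣N⁺∣ : ∀ (G : Digraph n) x → outdeg G x ≡ ∣ N⁺ G x ∣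
  outdeg≡∣N⁺∣ G x = length-filter-tabulate (adj G x) (λ y → y)

  indeg≡∣N⁻∣ : ∀ (G : Digraph n) x → indeg G x ≡ ∣ N⁻ G x ∣
  indeg≡∣N⁻∣ G x = length-filter-tabulate (λ y → adj G y x) (λ y → y)

  _ᵒᵖ : Digraph n → Digraph n
  G ᵒᵖ = record { adj = λ x y → adj G y x ; noLoops = noLoops G }

  edge⇒≢ : ∀ (G : Digraph n) {x y} → adj G x y ≡ true → x ≢ y
  edge⇒≢ G {x} x→y refl with trans (sym x→y) (noLoops G x)
  ... | ()

  TournamentIn : Digraph n → Subset n → ℕ → Set
  TournamentIn G U m =
    Σ (Fin m → Fin n) λ f → (∀ i → f i ∈ U) × (∀ i j → toℕ i ℕ.< toℕ j → adj G (f i) (f j) ≡ true)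

  singleton : ∀ G {U y} → y ∈ U → TournamentIn G U 1
  singleton G {y = y} y∈U = (λ _ → y) , (λ _ → y∈U) , λ { zero zero () }

  prepend : ∀ G {U x m} → x ∈ U → TournamentIn G (U ∩ N⁺ G x) m → TournamentIn G U (suc m)
  prepend G {U} {x} x∈U (f , f∈ , f→) = g , g∈ , g→
    where
    g : Fin _ → Fin n
    g zero    = x
    g (suc i) = f i
    g∈ : ∀ i → g i ∈ U
    g∈ zero    = x∈U
    g∈ (suc i) = p∩q⊆p U (N⁺ G x) (f∈ i)
    g→ : ∀ i j → toℕ i ℕ.< toℕ j → adj G (g i) (g j) ≡ true
    g→ zero    (suc j) _         = ∈tabulate⁻ (p∩q⊆q U (N⁺ G x) (f∈ j))
    g→ (suc i) (suc j) (s≤s i<j) = f→ i j i<j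

  opposite-reverses-< : ∀ {m} {i j : Fin m} → toℕ i ℕ.< toℕ j → toℕ (opposite j) ℕ.< toℕ (opposite i)
  opposite-reverses-< {m} {i} {j} i<j rewrite Fin.opposite-prop i | Fin.opposite-prop j =
    ℕ.∸-monoʳ-< (s≤s i<j) (Fin.toℕ<n j)

  reverse : ∀ G {U m} → TournamentIn G U m → TournamentIn (G ᵒᵖ) U m
  reverse G (f , f∈ , f→) = (λ i → f (opposite i)) , (λ i → f∈ (opposite i)) ,
                          λ i j i<j → f→ (opposite j) (opposite i) (opposite-reverses-< i<j)

  -- Since G has no loops, a tournament automatically has distinct vertices.
  tournament⇒ContainsTT : ∀ G {U m} → TournamentIn G U m → ContainsTT G m
  tournament⇒ContainsTT G (f , _ , f→) = f , injective , f→
    where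
    injective : Injective _≡_ _≡_ f
    injective {i} {j} fi≡fj with ℕ.<-cmp (toℕ i) (toℕ j)
    ... | tri< i<j _ _ = contradiction fi≡fj (edge⇒≢ G (f→ i j i<j))
    ... | tri≈ _ i≡j _ = Fin.toℕ-injective i≡j
    ... | tri> _ _ j<i = contradiction (sym fi≡fj) (edge⇒≢ G (f→ j i j<i))

  EdgeIn : Digraph n → Subset n → Set
  EdgeIn G U = ∃[ x ] ∃[ y ] x ∈ U × y ∈ U × adj G x y ≡ true

  edgeOrIndependent : ∀ (G : Digraph n) (U : Subset n) → EdgeIn G U ⊎ Independent G U
  edgeOrIndependent G U
    with Fin.any? (λ x → Fin.any? (λ y → x ∈? U ×-dec y ∈? U ×-dec adj G x y ≟ᵇ true))
  ... | yes edge = inj₁ edge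
  ... | no noEdge = inj₂ λ x y x∈U y∈U → ¬-not (λ x→y → noEdge (x , y , x∈U , y∈U , x→y))

module Greedy {n : ℕ} (D : ℚ) (0≤D : 0ℚ ≤ℚ D) where

  Dense : Digraph n → Subset n → Set
  Dense G U = ∀ y → y ∈ U → ℕtoℚ ∣ U ─ N⁺ G y ∣ ≤ℚ D ⊎ ℕtoℚ ∣ U ─ N⁻ G y ∣ ≤ℚ D

  dense-ᵒᵖ : ∀ G {U} → Dense G U → Dense (G ᵒᵖ) U
  dense-ᵒᵖ G dense y y∈U = swap (dense y y∈U)

  dense-∩ : ∀ G {U} B → Dense G U → Dense G (U ∩ B)
  dense-∩ G {U} B dense y y∈U∩B =
    ⊎-map (≤-trans (ℕtoℚ-mono (∣∩─∣≤∣─∣ U B (N⁺ G y))))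
          (≤-trans (ℕtoℚ-mono (∣∩─∣≤∣─∣ U B (N⁻ G y))))
          (dense y (p∩q⊆p U B y∈U∩B))

  Result : Digraph n → ℕ → Subset n → Set
  Result G k U = TournamentIn G U (suc (suc k))
               ⊎ Σ (Subset n) λ S → Independent G S × ℕtoℚ ∣ U ∣ ≤ℚ ℕtoℚ ∣ S ∣ + ℕtoℚ k * D

  independentResult : ∀ G {U} k → Independent G U → Result G k U
  independentResult G {U} k indep =
    inj₂ (U , indep , p≤p+q (ℕtoℚ ∣ U ∣) (*-nonNeg (ℕtoℚ-nonNeg k) 0≤D))

  result-ᵒᵖ : ∀ G {U} k → Result G k U → Result (G ᵒᵖ) k U
  result-ᵒᵖ G k (inj₁ tournament)          = inj₁ (reverse G tournament)
  result-ᵒᵖ G k (inj₂ (S , indep , bound)) = inj₂ (S , (λ x y x∈S y∈S → indep y x y∈S x∈S) , bound)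

  -- Removing at most D vertices costs one more D in the size bound.
  shrinkBound : ∀ k {u u′ d s} → u ≡ u′ + d → u′ ≤ℚ s + ℕtoℚ k * D → d ≤ℚ D →
                u ≤ℚ s + ℕtoℚ (suc k) * D
  shrinkBound k {u} {u′} {d} {s} u≡u′+d u′≤ d≤D = begin
    u                          ≡⟨ u≡u′+d ⟩
    u′ + d                     ≤⟨ +-mono-≤ u′≤ d≤D ⟩
    s + ℕtoℚ k * D + D         ≡⟨ solve 3 (λ s K D → s :+ K :* D :+ D := s :+ (con 1ℚ :+ K) :* D) refl s (ℕtoℚ k) D ⟩
    s + (1ℚ + ℕtoℚ k) * D      ≡⟨ cong (λ t → s + t * D) (ℕtoℚ-+ 1 k) ⟨
    s + ℕtoℚ (suc k) * D       ∎
    where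
    open ≤-Reasoning
    open +-*-Solver

  extendOut : ∀ G {U x} k → Result G k (U ∩ N⁺ G x) → x ∈ U →
              ℕtoℚ ∣ U ─ N⁺ G x ∣ ≤ℚ D → Result G (suc k) U
  extendOut G k (inj₁ tournament) x∈U _ = inj₁ (prepend G x∈U tournament)
  extendOut G {U} {x} k (inj₂ (S , indep , bound)) x∈U few =
    inj₂ (S , indep , shrinkBound k {s = ℕtoℚ ∣ S ∣} split bound few)
    where
    split : ℕtoℚ ∣ U ∣ ≡ ℕtoℚ ∣ U ∩ N⁺ G x ∣ + ℕtoℚ ∣ U ─ N⁺ G x ∣
    split = trans (cong ℕtoℚ (sym (∣∩∣+∣─∣≡∣∣ U (N⁺ G x)))) (ℕtoℚ-+ ∣ U ∩ N⁺ G x ∣ ∣ U ─ N⁺ G x ∣)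

  -- The greedy lemma.  If U is not independent it contains a vertex x; the in-case
  -- is the out-case in Gᵒᵖ, where N⁺ Gᵒᵖ x is N⁻ G x.
  greedy : ∀ k G U → Dense G U → Result G k U
  greedy zero G U _ = [ viaEdge , independentResult G zero ]′ (edgeOrIndependent G U)
    where
    viaEdge : EdgeIn G U → Result G zero U
    viaEdge (x , y , x∈U , y∈U , x→y) =
      inj₁ (prepend G x∈U (singleton G (x∈p∩q⁺ (y∈U , ∈tabulate⁺ x→y))))
  greedy (suc k) G U dense = [ viaVertex , independentResult G (suc k) ]′ (edgeOrIndependent G U)
    where
    viaVertex : EdgeIn G U → Result G (suc k) U
    viaVertex (x , _ , x∈U , _) = [ viaOut , viaIn ]′ (dense x x∈U)
      where
      viaOut : ℕtoℚ ∣ U ─ N⁺ G x ∣ ≤ℚ D → Result G (suc k) U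
      viaOut = extendOut G k (greedy k G (U ∩ N⁺ G x) (dense-∩ G (N⁺ G x) dense)) x∈U
      viaIn : ℕtoℚ ∣ U ─ N⁻ G x ∣ ≤ℚ D → Result G (suc k) U
      viaIn fewIn = result-ᵒᵖ (G ᵒᵖ) (suc k)
        (extendOut (G ᵒᵖ) k (greedy k (G ᵒᵖ) (U ∩ N⁻ G x) (dense-∩ (G ᵒᵖ) (N⁻ G x) (dense-ᵒᵖ G dense))) x∈U fewIn)

module Bounds (k : ℕ) (α N : ℚ) where

  i : ℚ
  i = inv (suc k)

  D : ℚ
  D = (i + α) * N

  complementBound : ∀ {a b} → a + b ≡ N → (1ℚ - i - α) * N ≤ℚ a → b ≤ℚ D
  complementBound {a} {b} a+b≡N lower = +-cancelʳ-≤ b D ((1ℚ - i - α) * N) (begin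
    b + (1ℚ - i - α) * N   ≤⟨ +-monoʳ-≤ b lower ⟩
    b + a                  ≡⟨ trans (+-comm b a) a+b≡N ⟩
    N                      ≡⟨ solve 3 (λ i α N → N := (i :+ α) :* N :+ (con 1ℚ :- i :- α) :* N) refl i α N ⟩
    D + (1ℚ - i - α) * N   ∎)
    where
    open ≤-Reasoning
    open +-*-Solver

  -- With T = (i - rα)N, the bound T + kD + 2αN = N uses (k+1)·i = 1.
  balance : (i - ℕtoℚ (suc (suc k)) * α) * N + ℕtoℚ k * D + (α * N + α * N) ≡ N
  balance = begin
    (i - ℕtoℚ (suc (suc k)) * α) * N + K * D + (α * N + α * N)
      ≡⟨ cong (λ t → (i - t * α) * N + K * D + (α * N + α * N)) r≡2+K ⟩
    (i - (1ℚ + (1ℚ + K)) * α) * N + K * D + (α * N + α * N)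
      ≡⟨ solve 4 (λ K i α N →
           (i :- (con 1ℚ :+ (con 1ℚ :+ K)) :* α) :* N :+ K :* ((i :+ α) :* N) :+ (α :* N :+ α :* N)
           := N :+ ((con 1ℚ :+ K) :* i :- con 1ℚ) :* N) refl K i α N ⟩
    N + ((1ℚ + K) * i - 1ℚ) * N
      ≡⟨ cong (λ t → N + (t * i - 1ℚ) * N) (ℕtoℚ-+ 1 k) ⟨
    N + (ℕtoℚ (suc k) * i - 1ℚ) * N
      ≡⟨ cong (λ t → N + (t - 1ℚ) * N) (ℕtoℚ*inv k) ⟩
    N + (1ℚ - 1ℚ) * N
      ≡⟨ solve 1 (λ N → N :+ (con 1ℚ :- con 1ℚ) :* N := N) refl N ⟩
    N ∎
    where
    open ≡-Reasoning
    open +-*-Solver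
    K : ℚ
    K = ℕtoℚ k
    r≡2+K : ℕtoℚ (suc (suc k)) ≡ 1ℚ + (1ℚ + K)
    r≡2+K = trans (ℕtoℚ-+ 1 (suc k)) (cong (λ t → 1ℚ + t) (ℕtoℚ-+ 1 k))

  finalBound : ∀ {s} → 0ℚ ≤ℚ α → 0ℚ ≤ℚ N → N ≤ℚ s + ℕtoℚ k * D →
               (i - ℕtoℚ (suc (suc k)) * α) * N ≤ℚ s
  finalBound {s} 0≤α 0≤N N≤s+kD = +-cancelʳ-≤ T s (ℕtoℚ k * D) (begin
    T + ℕtoℚ k * D                    ≤⟨ p≤p+q (T + ℕtoℚ k * D) (+-mono-≤ 0≤αN 0≤αN) ⟩
    T + ℕtoℚ k * D + (α * N + α * N)  ≡⟨ balance ⟩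
    N                                 ≤⟨ N≤s+kD ⟩
    s + ℕtoℚ k * D                    ∎)
    where
    open ≤-Reasoning
    T : ℚ
    T = (i - ℕtoℚ (suc (suc k)) * α) * N
    0≤αN : 0ℚ ≤ℚ α * N
    0≤αN = *-nonNeg 0≤α 0≤N

-- The proposition for r = k + 2 (any k ≥ 0, in particular r ≥ 3) and fixed α ≥ 0.

module Proposition (k : ℕ) (α : ℚ) (0≤α : 0ℚ ≤ℚ α) {n : ℕ} where

  open Bounds k α (ℕtoℚ n)

  0≤D : 0ℚ ≤ℚ D
  0≤D = *-nonNeg (+-mono-≤ (nonNegative⁻¹ i {{normalize-nonNeg 1 (suc k)}}) 0≤α) (ℕtoℚ-nonNeg n)

  open Greedy {n} D 0≤D using (Dense; Result; greedy)

  V : Subset n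
  V = ⊤

  DegreeCondition : Digraph n → Set
  DegreeCondition G = ∀ x → ((1ℚ - i - α) * ℕtoℚ n ≤ℚ ℕtoℚ (outdeg G x))
                          ⊎ ((1ℚ - i - α) * ℕtoℚ n ≤ℚ ℕtoℚ (indeg G x))

  missingFew : ∀ (A : Subset n) → (1ℚ - i - α) * ℕtoℚ n ≤ℚ ℕtoℚ ∣ A ∣ → ℕtoℚ ∣ V ─ A ∣ ≤ℚ D
  missingFew A = complementBound {ℕtoℚ ∣ A ∣} {ℕtoℚ ∣ V ─ A ∣} (begin
    ℕtoℚ ∣ A ∣ + ℕtoℚ ∣ V ─ A ∣       ≡⟨ ℕtoℚ-+ ∣ A ∣ ∣ V ─ A ∣ ⟨
    ℕtoℚ (∣ A ∣ ℕ.+ ∣ V ─ A ∣)        ≡⟨ cong (λ B → ℕtoℚ (∣ B ∣ ℕ.+ ∣ V ─ A ∣)) (∩-identityˡ A) ⟨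
    ℕtoℚ (∣ V ∩ A ∣ ℕ.+ ∣ V ─ A ∣)    ≡⟨ cong ℕtoℚ (trans (∣∩∣+∣─∣≡∣∣ V A) (∣⊤∣≡n n)) ⟩
    ℕtoℚ n                            ∎)
    where open ≡-Reasoning

  degreeCondition⇒dense : ∀ (G : Digraph n) → DegreeCondition G → Dense G V
  degreeCondition⇒dense G degrees x _ =
    ⊎-map (λ out → missingFew (N⁺ G x) (subst (λ d → (1ℚ - i - α) * ℕtoℚ n ≤ℚ ℕtoℚ d) (outdeg≡∣N⁺∣ G x) out))
          (λ in′ → missingFew (N⁻ G x) (subst (λ d → (1ℚ - i - α) * ℕtoℚ n ≤ℚ ℕtoℚ d) (indeg≡∣N⁻∣ G x) in′))
          (degrees x)

  largeIndependentSet : ∀ (G : Digraph n) → DegreeCondition G → ¬ ContainsTT G (suc (suc k)) →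
    Σ (Subset n) λ S → Independent G S × ((i - ℕtoℚ (suc (suc k)) * α) * ℕtoℚ n ≤ℚ ℕtoℚ ∣ S ∣)
  largeIndependentSet G degrees noTT = conclude (greedy k G V (degreeCondition⇒dense G degrees))
    where
    conclude : Result G k V →
      Σ (Subset n) λ S → Independent G S × ((i - ℕtoℚ (suc (suc k)) * α) * ℕtoℚ n ≤ℚ ℕtoℚ ∣ S ∣)
    conclude (inj₁ tournament)          = contradiction (tournament⇒ContainsTT G tournament) noTT
    conclude (inj₂ (S , indep , bound)) = S , indep , finalBound {ℕtoℚ ∣ S ∣} 0≤α (ℕtoℚ-nonNeg n)
      (subst (λ m → ℕtoℚ m ≤ℚ ℕtoℚ ∣ S ∣ + ℕtoℚ k * D) (∣⊤∣≡n n) bound)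

proposition6p5 :
  ∀ (r : ℕ) → 3 ≤ r →
  Σ ℚ λ α₀ → 0ℚ < α₀ ×
    (∀ (α : ℚ) → 0ℚ < α → α ≤ℚ α₀ →
      Σ ℕ λ n₀ →
        ∀ (n : ℕ) → n₀ ≤ n → (G : Digraph n) →
          (∀ x → ((1ℚ - inv (r ∸ 1) - α) * ℕtoℚ n ≤ℚ ℕtoℚ (outdeg G x))
               ⊎ ((1ℚ - inv (r ∸ 1) - α) * ℕtoℚ n ≤ℚ ℕtoℚ (indeg G x))) →
          ¬ ContainsTT G r →
          Σ (Subset n) λ S → Independent G S ×
            ((inv (r ∸ 1) - ℕtoℚ r * α) * ℕtoℚ n ≤ℚ ℕtoℚ ∣ S ∣))
proposition6p5 (suc (suc k)) (s≤s (s≤s _)) =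
  1ℚ , *<* (ℤ.+<+ (s≤s ℕ.z≤n)) , λ α 0<α _ →
    0 , λ n _ → Proposition.largeIndependentSet k α (<⇒≤ 0<α)
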